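{- Let $H$ be a graph with vertex set $\{v_1,\dots,v_{n(H)}\}$, let $\mathcal{X}=\{X_i:1\le i\le n(H)\}$ be a family of graphs, each with at least one vertex, and let $G=H\circ\mathcal{X}$. Then $G$ is a König–Egerváry graph with a perfect matching if and only if each $X_i$ is a König–Egerváry graph with an almost perfect matching.
   Context: All graphs are finite, simple and undirected. A graph $G$ is König–Egerváry if $\alpha(G)+\mu(G)=n(G)$, where $\alpha$ is the independence number, $\mu$ the maximum matching size and $n(G)$ the number of vertices. A perfect matching saturates all vertices; an almost perfect matching is a matching leaving exactly one vertex unsaturated. The corona $H\circ\mathcal{X}$ is obtained from the disjoint union of $H$ and $X_1,\dots,X_{n(H)}$ by joining each $v_i$ to all vertices of $X_i$. -}

module Defs where

open import Level using (0ℓ)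
open import Data.Nat using (ℕ; _+_; _≤_)
open import Data.Fin using (Fin)
open import Data.Fin.Properties using (_≟_)
open import Data.Product using (Σ; ∃; ∃-syntax; _×_; _,_; proj₁; proj₂)
open import Data.Sum using (_⊎_; inj₁; inj₂)
open import Data.List using (List; []; _∷_; length; concatMap)
open import Data.List.Membership.Propositional using (_∈_; _∉_)
open import Data.List.Relation.Unary.Unique.Propositional using (Unique)
open import Data.Empty using (⊥)
open import Relation.Nullary using (¬_)
open import Relation.Binary.PropositionalEquality using (_≡_; _≢_; refl; subst) renaming (sym to ≡-sym)
open import Axiom.UniquenessOfIdentityProofs using (module Decidable⇒UIP)

record SimpleGraph (V : Set) : Set₁ where
  field
    Adj    : V → V → Set
    adj-sym : ∀ {u v} → Adj u v → Adj v u
    irrefl : ∀ {v} → ¬ Adj v v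
open SimpleGraph public

module _ {V : Set} (G : SimpleGraph V) where

  HasOrder : ℕ → Set
  HasOrder k = Σ (List V) λ vs → Unique vs × (∀ v → v ∈ vs) × length vs ≡ k

  IsIndependent : List V → Set
  IsIndependent S = Unique S × (∀ {u v} → u ∈ S → v ∈ S → ¬ Adj G u v)

  IsIndependenceNumber : ℕ → Set
  IsIndependenceNumber a =
    (Σ (List V) λ S → IsIndependent S × length S ≡ a) ×
    (∀ S → IsIndependent S → length S ≤ a)

  endpoints : List (V × V) → List V
  endpoints = concatMap (λ e → proj₁ e ∷ proj₂ e ∷ [])

  IsMatching : List (V × V) → Set
  IsMatching M = (∀ {e} → e ∈ M → Adj G (proj₁ e) (proj₂ e)) × Unique (endpoints M)

  IsMatchingNumber : ℕ → Set
  IsMatchingNumber m =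
    (Σ (List (V × V)) λ M → IsMatching M × length M ≡ m) ×
    (∀ M → IsMatching M → length M ≤ m)

  IsKE : Set
  IsKE = ∃[ n ] ∃[ a ] ∃[ m ]
    HasOrder n × IsIndependenceNumber a × IsMatchingNumber m × a + m ≡ n

  HasPerfectMatching : Set
  HasPerfectMatching = Σ (List (V × V)) λ M → IsMatching M × (∀ v → v ∈ endpoints M)

  HasAlmostPerfectMatching : Set
  HasAlmostPerfectMatching = Σ (List (V × V)) λ M → IsMatching M ×
    Σ V λ w → w ∉ endpoints M × (∀ v → v ≢ w → v ∈ endpoints M)

-- Corona H ∘ X, where H has vertices Fin h (v₁ … v_h) and
-- X i is a graph on Fin (s i).  Vertices: inj₁ i is v_i ; inj₂ (i , x) is
-- the vertex x of the copy of X i.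

CoronaV : (h : ℕ) (s : Fin h → ℕ) → Set
CoronaV h s = Fin h ⊎ Σ (Fin h) (λ i → Fin (s i))

module _ {h : ℕ} {s : Fin h → ℕ} (H : SimpleGraph (Fin h))
         (X : (i : Fin h) → SimpleGraph (Fin (s i))) where

  XAdj : Σ (Fin h) (λ i → Fin (s i)) → Σ (Fin h) (λ i → Fin (s i)) → Set
  XAdj (i , x) (j , y) = Σ (i ≡ j) λ p → Adj (X j) (subst (λ k → Fin (s k)) p x) y

  cAdj : CoronaV h s → CoronaV h s → Set
  cAdj (inj₁ a) (inj₁ b) = Adj H a b
  cAdj (inj₁ a) (inj₂ (i , x)) = a ≡ i
  cAdj (inj₂ (i , x)) (inj₁ a) = i ≡ a
  cAdj (inj₂ p) (inj₂ q) = XAdj p q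

  cSym : ∀ {u v} → cAdj u v → cAdj v u
  cSym {inj₁ a} {inj₁ b} e = SimpleGraph.adj-sym H e
  cSym {inj₁ a} {inj₂ _} e = ≡-sym e
  cSym {inj₂ _} {inj₁ a} e = ≡-sym e
  cSym {inj₂ (i , x)} {inj₂ (.i , y)} (refl , e) = refl , SimpleGraph.adj-sym (X i) e

  cIrr : ∀ {v} → ¬ cAdj v v
  cIrr {inj₁ a} e = irrefl H e
  cIrr {inj₂ (i , x)} (p , e) with Decidable⇒UIP.≡-irrelevant _≟_ p refl
  ... | refl = irrefl (X i) e

  corona : SimpleGraph (CoronaV h s)
  corona = record { Adj = cAdj ; adj-sym = λ {u} {v} → cSym {u} {v} ; irrefl = λ {v} → cIrr {v} }

-- A matching leaving at most one vertex unsaturated is maximum, so a graph with a perfect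
-- (almost perfect) matching M is König–Egerváry exactly when it has an independent set of
-- size |M| (|M| + 1).
--
-- (⇐) The almost perfect matchings of the X i, together with the edges joining each v i to the
-- vertex left unsaturated in X i, form a perfect matching of G, and the union of independent
-- sets of size |M i| + 1 in the X i is an independent set of G of the same size.
--
-- (⇒) An independent set S of size |M| meets every edge of a perfect matching M. Two hubs are
-- never matched to each other: one of them, v i, would lie in S, and a leaf of X i would then be
-- matched inside X i by an edge meeting S next to v i. So each v i is matched to some w i in X i,
-- M restricted to X i is almost perfect with w i unsaturated, and w i together with the
-- S-endpoints of those edges (or w i alone, when v i ∈ S) is independent of size |M i| + 1.

{-# OPTIONS --safe #-}
module Submission where

open import Defs
open import Level using (0ℓ)
open import Data.Nat using (ℕ; suc; _+_; _≤_; _<_; z≤n; s≤s)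
open import Data.Nat.Properties
  using ( ≤-refl; ≤-antisym; ≮⇒≥; <⇒≱; 1+n≰n; +-suc; +-assoc; +-mono-≤; +-monoˡ-≤
        ; +-cancelʳ-≤; +-cancelʳ-≡; module ≤-Reasoning)
open import Data.Fin using (Fin; fromℕ<)
import Data.Fin.Properties as Fin
open import Data.Product using (Σ; ∃; ∃₂; _×_; _,_; proj₁; proj₂)
import Data.Product as Product
open import Data.Product.Properties using () renaming (≡-dec to ≡-dec-Σ)
open import Data.Sum using (_⊎_; inj₁; inj₂; [_,_])
import Data.Sum as Sum
open import Data.Sum.Properties using () renaming (≡-dec to ≡-dec-⊎)
open import Data.List using (List; []; _∷_; _++_; length; map; concatMap; filter; allFin)
open import Data.List.Properties using (length-++; length-map; length-removeAt′; filter-notAll)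
open import Data.List.Relation.Unary.Any using (here; there; index; _─_)
import Data.List.Relation.Unary.All as All
open import Data.List.Relation.Unary.All.Properties using (¬Any⇒All¬)
open import Data.List.Relation.Unary.AllPairs using ([]; _∷_)
open import Data.List.Membership.Propositional using (_∈_; _∉_; find; lose)
open import Data.List.Membership.Propositional.Properties
  using (∈-map⁺; ∈-map⁻; ∈-concatMap⁺; ∈-concatMap⁻; ∈-filter⁺; ∈-allFin)
import Data.List.Membership.DecPropositional as DecMembership
open import Data.List.Relation.Unary.Unique.Propositional using (Unique)
open import Data.List.Relation.Unary.Unique.Propositional.Properties using (++⁺; map⁺; allFin⁺)
open import Data.Empty using (⊥-elim)
open import Function using (_∘_; _∋_)
open import Function.Bundles using (_⇔_; mk⇔; Equivalence)
open import Relation.Nullary using (¬_; yes; no; contradiction)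
open import Relation.Nullary.Decidable using (_⊎-dec_; ¬?; decidable-stable)
open import Relation.Unary using (Pred; Decidable)
open import Relation.Binary.Definitions using (DecidableEquality)
open import Relation.Binary.PropositionalEquality
  using (_≡_; _≢_; refl; sym; trans; cong; cong₂; subst; subst₂; module ≡-Reasoning)
open import Axiom.UniquenessOfIdentityProofs using (module Decidable⇒UIP)

module _ {A : Set} where

  Unique-∷ : ∀ {x : A} {xs} → x ∉ xs → Unique xs → Unique (x ∷ xs)
  Unique-∷ {xs = xs} x∉xs xs! = ¬Any⇒All¬ xs x∉xs ∷ xs!

  ∈-∷-complete : DecidableEquality A → ∀ {w : A} {xs} → (∀ v → v ≢ w → v ∈ xs) → ∀ v → v ∈ w ∷ xs
  ∈-∷-complete _≟_ {w} others v with v ≟ w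
  ... | yes refl = here refl
  ... | no v≢w = there (others v v≢w)

  no-members⇒≡[] : ∀ {xs : List A} → (∀ {x} → x ∉ xs) → xs ≡ []
  no-members⇒≡[] {[]} _ = refl
  no-members⇒≡[] {_ ∷ _} ∉xs = ⊥-elim (∉xs (here refl))

  ∈-─ : ∀ {x y : A} {xs} → y ∈ xs → y ≢ x → (x∈xs : x ∈ xs) → y ∈ (xs ─ x∈xs)
  ∈-─ (here refl) y≢x (here refl) = ⊥-elim (y≢x refl)
  ∈-─ (there y∈xs) _ (here _) = y∈xs
  ∈-─ (here refl) _ (there _) = here refl
  ∈-─ (there y∈xs) y≢x (there x∈xs) = there (∈-─ y∈xs y≢x x∈xs)

  Unique-⊆⇒length≤ : ∀ {xs ys : List A} → Unique xs → (∀ {z} → z ∈ xs → z ∈ ys) → length xs ≤ length ys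
  Unique-⊆⇒length≤ [] _ = z≤n
  Unique-⊆⇒length≤ {x ∷ xs} {ys} (x≢xs ∷ xs!) xs⊆ys = begin
    suc (length xs)          ≤⟨ s≤s (Unique-⊆⇒length≤ xs! xs⊆ys─x) ⟩
    suc (length (ys ─ x∈ys)) ≡⟨ sym (length-removeAt′ ys (index x∈ys)) ⟩
    length ys                ∎
    where
    open ≤-Reasoning
    x∈ys : x ∈ ys
    x∈ys = xs⊆ys (here refl)
    xs⊆ys─x : ∀ {z} → z ∈ xs → z ∈ (ys ─ x∈ys)
    xs⊆ys─x z∈xs = ∈-─ (xs⊆ys (there z∈xs)) (λ z≡x → All.lookup x≢xs z∈xs (sym z≡x)) x∈ys

module _ {I A : Set} (f : I → List A) where

  Unique-concatMap : (owner : A → I) → (∀ i {x} → x ∈ f i → owner x ≡ i) →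
    (∀ i → Unique (f i)) → ∀ {is} → Unique is → Unique (concatMap f is)
  Unique-concatMap owner owned f! [] = []
  Unique-concatMap owner owned f! {i ∷ is} (i≢is ∷ is!) =
    ++⁺ (f! i) (Unique-concatMap owner owned f! is!) disjoint
    where
    disjoint : ∀ {x} → ¬ (x ∈ f i × x ∈ concatMap f is)
    disjoint (x∈fi , x∈rest) with j , j∈is , x∈fj ← find (∈-concatMap⁻ f x∈rest) =
      All.lookup i≢is j∈is (trans (sym (owned i x∈fi)) (owned j x∈fj))

  length-concatMap-cong : ∀ {B : Set} (g : I → List B) → (∀ i → length (f i) ≡ length (g i)) →
    ∀ is → length (concatMap f is) ≡ length (concatMap g is)
  length-concatMap-cong g eq [] = refl
  length-concatMap-cong g eq (i ∷ is) = begin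
    length (f i ++ concatMap f is)         ≡⟨ length-++ (f i) ⟩
    length (f i) + length (concatMap f is) ≡⟨ cong₂ _+_ (eq i) (length-concatMap-cong g eq is) ⟩
    length (g i) + length (concatMap g is) ≡⟨ sym (length-++ (g i)) ⟩
    length (g i ++ concatMap g is)         ∎
    where open ≡-Reasoning

m+m≤k+[n+n]⇒m≤n : ∀ {k m n} → k ≤ 1 → m + m ≤ k + (n + n) → m ≤ n
m+m≤k+[n+n]⇒m≤n {k} {m} {n} k≤1 m+m≤ = ≮⇒≥ λ n<m → 1+n≰n (begin
  suc (suc (n + n)) ≡⟨ cong suc (sym (+-suc n n)) ⟩
  suc n + suc n     ≤⟨ +-mono-≤ n<m n<m ⟩
  m + m             ≤⟨ m+m≤ ⟩
  k + (n + n)       ≤⟨ +-monoˡ-≤ (n + n) k≤1 ⟩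
  suc (n + n)       ∎)
  where open ≤-Reasoning

module Matchings {V : Set} (G : SimpleGraph V) where

  HasIndependentSetOfSize : ℕ → Set
  HasIndependentSetOfSize k = Σ (List V) λ S → IsIndependent G S × length S ≡ k

  Matched : List (V × V) → V → V → Set
  Matched M u v = (u , v) ∈ M ⊎ (v , u) ∈ M

  Matched-sym : ∀ {M u v} → Matched M u v → Matched M v u
  Matched-sym = Sum.swap

  Matched⇒Adj : ∀ {M u v} → IsMatching G M → Matched M u v → Adj G u v
  Matched⇒Adj M-matching (inj₁ uv∈M) = proj₁ M-matching uv∈M
  Matched⇒Adj M-matching (inj₂ vu∈M) = adj-sym G (proj₁ M-matching vu∈M)

  Matched-∷⁻ : ∀ {a b M u v} → Matched ((a , b) ∷ M) u v →
    (u ≡ a × v ≡ b) ⊎ (u ≡ b × v ≡ a) ⊎ Matched M u v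
  Matched-∷⁻ (inj₁ (here refl)) = inj₁ (refl , refl)
  Matched-∷⁻ (inj₂ (here refl)) = inj₂ (inj₁ (refl , refl))
  Matched-∷⁻ (inj₁ (there uv∈M)) = inj₂ (inj₂ (inj₁ uv∈M))
  Matched-∷⁻ (inj₂ (there vu∈M)) = inj₂ (inj₂ (inj₂ vu∈M))

  Matched⇒∈endpoints : ∀ {M u v} → Matched M u v → u ∈ endpoints G M
  Matched⇒∈endpoints (inj₁ (here refl)) = here refl
  Matched⇒∈endpoints (inj₂ (here refl)) = there (here refl)
  Matched⇒∈endpoints {_ ∷ _} (inj₁ (there uv∈M)) = there (there (Matched⇒∈endpoints (inj₁ uv∈M)))
  Matched⇒∈endpoints {_ ∷ _} (inj₂ (there vu∈M)) = there (there (Matched⇒∈endpoints (inj₂ vu∈M)))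

  ∈endpoints⇒Matched : ∀ {M u} → u ∈ endpoints G M → ∃ (Matched M u)
  ∈endpoints⇒Matched {(a , b) ∷ M} (here refl) = b , inj₁ (here refl)
  ∈endpoints⇒Matched {(a , b) ∷ M} (there (here refl)) = a , inj₂ (here refl)
  ∈endpoints⇒Matched {_ ∷ M} (there (there u∈)) =
    Product.map₂ (Sum.map there there) (∈endpoints⇒Matched u∈)

  Matched-unique : ∀ {M u v v′} → Unique (endpoints G M) → Matched M u v → Matched M u v′ → v ≡ v′
  Matched-unique {[]} _ (inj₁ ()) _
  Matched-unique {[]} _ (inj₂ ()) _
  Matched-unique {(a , b) ∷ M} (a≢ ∷ b≢ ∷ M!) m m′ with Matched-∷⁻ m | Matched-∷⁻ m′
  ... | inj₁ (refl , refl) | inj₁ (refl , refl) = refl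
  ... | inj₂ (inj₁ (refl , refl)) | inj₂ (inj₁ (refl , refl)) = refl
  ... | inj₂ (inj₂ m₀) | inj₂ (inj₂ m₀′) = Matched-unique M! m₀ m₀′
  ... | inj₁ (refl , refl) | inj₂ (inj₁ (refl , refl)) = ⊥-elim (All.head a≢ refl)
  ... | inj₂ (inj₁ (refl , refl)) | inj₁ (refl , refl) = ⊥-elim (All.head a≢ refl)
  ... | inj₁ (refl , refl) | inj₂ (inj₂ m₀′) =
    ⊥-elim (All.lookup a≢ (there (Matched⇒∈endpoints m₀′)) refl)
  ... | inj₂ (inj₂ m₀) | inj₁ (refl , refl) =
    ⊥-elim (All.lookup a≢ (there (Matched⇒∈endpoints m₀)) refl)
  ... | inj₂ (inj₁ (refl , refl)) | inj₂ (inj₂ m₀′) =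
    ⊥-elim (All.lookup b≢ (Matched⇒∈endpoints m₀′) refl)
  ... | inj₂ (inj₂ m₀) | inj₂ (inj₁ (refl , refl)) =
    ⊥-elim (All.lookup b≢ (Matched⇒∈endpoints m₀) refl)

  length-endpoints : ∀ M → length (endpoints G M) ≡ length M + length M
  length-endpoints [] = refl
  length-endpoints (_ ∷ M) =
    cong suc (trans (cong suc (length-endpoints M)) (sym (+-suc (length M) (length M))))

  endpoints-concatMap : ∀ {I : Set} (f : I → List (V × V)) is →
    endpoints G (concatMap f is) ≡ concatMap (endpoints G ∘ f) is
  endpoints-concatMap f [] = refl
  endpoints-concatMap f (i ∷ is) =
    trans (endpoints-++ (f i)) (cong (endpoints G (f i) ++_) (endpoints-concatMap f is))
    where
    endpoints-++ : ∀ E {F} → endpoints G (E ++ F) ≡ endpoints G E ++ endpoints G F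
    endpoints-++ [] = refl
    endpoints-++ ((a , b) ∷ E) = cong (λ l → a ∷ b ∷ l) (endpoints-++ E)

  module _ {P : Pred V 0ℓ} (P? : Decidable P) where

    pickBy : V × V → V
    pickBy (a , b) with P? a
    ... | yes _ = a
    ... | no _ = b

    pickBy-yes : ∀ {a b} → P a → pickBy (a , b) ≡ a
    pickBy-yes {a} pa with P? a
    ... | yes _ = refl
    ... | no ¬pa = contradiction pa ¬pa

    pickBy-no : ∀ {a b} → ¬ P a → pickBy (a , b) ≡ b
    pickBy-no {a} ¬pa with P? a
    ... | yes pa = contradiction pa ¬pa
    ... | no _ = refl

    pickBy-sat : ∀ {a b} → P a ⊎ P b → P (pickBy (a , b))
    pickBy-sat {a} pa⊎pb with P? a
    ... | yes pa = pa
    ... | no ¬pa = [ (λ pa → contradiction pa ¬pa) , (λ pb → pb) ] pa⊎pb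

    pickBy-Matched : ∀ {M a b} → (a , b) ∈ M → ∃ (Matched M (pickBy (a , b)))
    pickBy-Matched {a = a} ab∈M with P? a
    ... | yes _ = _ , inj₁ ab∈M
    ... | no _ = _ , inj₂ ab∈M

    pickBy-∈-endpoints : ∀ {M z} → z ∈ map pickBy M → z ∈ endpoints G M
    pickBy-∈-endpoints z∈ with _ , ab∈M , refl ← ∈-map⁻ pickBy z∈ =
      Matched⇒∈endpoints (proj₂ (pickBy-Matched ab∈M))

    pickBy-Unique : ∀ M → Unique (endpoints G M) → Unique (map pickBy M)
    pickBy-Unique [] _ = []
    pickBy-Unique ((a , b) ∷ M) (a≢ ∷ b≢ ∷ M!) = Unique-∷ fresh (pickBy-Unique M M!)
      where
      fresh : pickBy (a , b) ∉ map pickBy M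
      fresh with P? a
      ... | yes _ = λ a∈ → All.lookup a≢ (there (pickBy-∈-endpoints a∈)) refl
      ... | no _ = λ b∈ → All.lookup b≢ (pickBy-∈-endpoints b∈) refl

  HasOrder⇒≡length : ∀ {n vs} → HasOrder G n → Unique vs → (∀ v → v ∈ vs) → n ≡ length vs
  HasOrder⇒≡length (vs′ , vs′! , vs′-complete , refl) vs! vs-complete =
    ≤-antisym (Unique-⊆⇒length≤ vs′! λ {v} _ → vs-complete v)
              (Unique-⊆⇒length≤ vs! λ {v} _ → vs′-complete v)

  matching≤order : ∀ {M vs} → IsMatching G M → (∀ v → v ∈ vs) → length M + length M ≤ length vs
  matching≤order {M} M-matching vs-complete =
    subst (_≤ _) (length-endpoints M) (Unique-⊆⇒length≤ (proj₂ M-matching) λ {v} _ → vs-complete v)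

  -- Each edge of M has an endpoint outside S; picking it embeds M into the complement of S.
  independent+matching≤order : DecidableEquality V → ∀ {S M vs} →
    IsIndependent G S → IsMatching G M → (∀ v → v ∈ vs) → length S + length M ≤ length vs
  independent+matching≤order _≟_ {S} {M} {vs} (S! , S-indep) M-matching vs-complete = begin
    length S + length M               ≡⟨ cong (length S +_) (sym (length-map outside M)) ⟩
    length S + length (map outside M) ≡⟨ sym (length-++ S) ⟩
    length (S ++ map outside M)       ≤⟨ Unique-⊆⇒length≤ S++outside! (λ {v} _ → vs-complete v) ⟩
    length vs                         ∎
    where
    open ≤-Reasoning
    open DecMembership _≟_ using (_∈?_)
    outside? : Decidable (_∉ S)
    outside? v = ¬? (v ∈? S)
    outside : V × V → V
    outside = pickBy outside?
    edge-leaves-S : ∀ {a b} → (a , b) ∈ M → a ∉ S ⊎ b ∉ S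
    edge-leaves-S {a} ab∈M with a ∈? S
    ... | yes a∈S = inj₂ λ b∈S → S-indep a∈S b∈S (proj₁ M-matching ab∈M)
    ... | no a∉S = inj₁ a∉S
    disjoint : ∀ {v} → ¬ (v ∈ S × v ∈ map outside M)
    disjoint (v∈S , v∈outside) with _ , ab∈M , refl ← ∈-map⁻ outside v∈outside =
      pickBy-sat outside? (edge-leaves-S ab∈M) v∈S
    S++outside! : Unique (S ++ map outside M)
    S++outside! = ++⁺ S! (pickBy-Unique outside? M (proj₂ M-matching)) disjoint

  module _ {M} (M-matching : IsMatching G M)
           {vs : List V} (vs! : Unique vs) (vs-complete : ∀ v → v ∈ vs)
           {k} (k≤1 : k ≤ 1) (|vs| : length vs ≡ k + (length M + length M)) where

    matching-maximum : ∀ {M′} → IsMatching G M′ → length M′ ≤ length M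
    matching-maximum M′-matching =
      m+m≤k+[n+n]⇒m≤n k≤1 (subst (_ ≤_) |vs| (matching≤order M′-matching vs-complete))

    isKE⇔independentSet : DecidableEquality V → IsKE G ⇔ HasIndependentSetOfSize (k + length M)
    isKE⇔independentSet _≟_ = mk⇔ isKE⇒independentSet independentSet⇒isKE
      where
      |vs|′ : length vs ≡ (k + length M) + length M
      |vs|′ = trans |vs| (sym (+-assoc k (length M) (length M)))

      independent≤ : ∀ S → IsIndependent G S → length S ≤ k + length M
      independent≤ S S-indep = +-cancelʳ-≤ (length M) (length S) (k + length M)
        (subst (_ ≤_) |vs|′ (independent+matching≤order _≟_ S-indep M-matching vs-complete))

      independentSet⇒isKE : HasIndependentSetOfSize (k + length M) → IsKE G
      independentSet⇒isKE S-size =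
        length vs , k + length M , length M ,
        (vs , vs! , vs-complete , refl) , (S-size , independent≤) ,
        ((M , M-matching , refl) , λ _ → matching-maximum) , sym |vs|′

      isKE⇒independentSet : IsKE G → HasIndependentSetOfSize (k + length M)
      isKE⇒independentSet
        (n , a , m , order , ((S , S-indep , |S|) , _) , ((M′ , M′-matching , refl) , μ-max) , a+m≡n) =
        S , S-indep , trans |S| a≡k+|M|
        where
        m≡|M| : m ≡ length M
        m≡|M| = ≤-antisym (matching-maximum M′-matching) (μ-max M M-matching)
        a≡k+|M| : a ≡ k + length M
        a≡k+|M| = +-cancelʳ-≡ (length M) a (k + length M) (begin
          a + length M            ≡⟨ cong (a +_) (sym m≡|M|) ⟩
          a + m                   ≡⟨ a+m≡n ⟩
          n                       ≡⟨ HasOrder⇒≡length order vs! vs-complete ⟩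
          length vs               ≡⟨ |vs|′ ⟩
          k + length M + length M ∎)
          where open ≡-Reasoning

  perfect-isKE⇔independentSet : DecidableEquality V → ∀ {M} →
    IsMatching G M → (∀ v → v ∈ endpoints G M) → IsKE G ⇔ HasIndependentSetOfSize (length M)
  perfect-isKE⇔independentSet _≟_ {M} M-matching M-perfect =
    isKE⇔independentSet M-matching (proj₂ M-matching) M-perfect z≤n (length-endpoints M) _≟_

  almostPerfect-isKE⇔independentSet : DecidableEquality V → ∀ {M w} → IsMatching G M →
    w ∉ endpoints G M → (∀ v → v ≢ w → v ∈ endpoints G M) →
    IsKE G ⇔ HasIndependentSetOfSize (1 + length M)
  almostPerfect-isKE⇔independentSet _≟_ {M} M-matching w-unsaturated others-saturated =
    isKE⇔independentSet M-matching (Unique-∷ w-unsaturated (proj₂ M-matching))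
      (∈-∷-complete _≟_ others-saturated) ≤-refl (cong suc (length-endpoints M)) _≟_

  -- Sending each vertex of S to the edge of M containing it is injective, as S is independent,
  -- so an edge missing S would leave fewer than |S| edges to receive it.
  perfect-independent-meets-edges : DecidableEquality V → ∀ {M S} → IsMatching G M →
    (∀ v → v ∈ endpoints G M) → IsIndependent G S → length S ≡ length M →
    ∀ {a b} → (a , b) ∈ M → a ∈ S ⊎ b ∈ S
  perfect-independent-meets-edges _≟_ {M} {S} M-matching M-perfect (S! , S-indep) |S|≡|M| {a} {b} ab∈M =
    decidable-stable (meets? (a , b)) λ misses → <⇒≱ (fewer misses) |M|≤|meeting|
    where
    open DecMembership _≟_ using (_∈?_)
    meets? : Decidable (λ (e : V × V) → proj₁ e ∈ S ⊎ proj₂ e ∈ S)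
    meets? (u , v) = u ∈? S ⊎-dec v ∈? S
    meeting : List (V × V)
    meeting = filter meets? M
    fewer : ¬ (a ∈ S ⊎ b ∈ S) → length meeting < length M
    fewer misses = filter-notAll meets? M (lose ab∈M misses)
    inS : V × V → V
    inS = pickBy (_∈? S)
    S⊆inS : ∀ {z} → z ∈ S → z ∈ map inS meeting
    S⊆inS {z} z∈S with ∈endpoints⇒Matched (M-perfect z)
    ... | _ , inj₁ zu∈M =
      subst (_∈ map inS meeting) (pickBy-yes (_∈? S) z∈S)
        (∈-map⁺ inS (∈-filter⁺ meets? zu∈M (inj₁ z∈S)))
    ... | _ , inj₂ uz∈M =
      subst (_∈ map inS meeting) (pickBy-no (_∈? S) λ u∈S → S-indep u∈S z∈S (proj₁ M-matching uz∈M))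
        (∈-map⁺ inS (∈-filter⁺ meets? uz∈M (inj₂ z∈S)))
    |M|≤|meeting| : length M ≤ length meeting
    |M|≤|meeting| = subst₂ _≤_ |S|≡|M| (length-map inS meeting) (Unique-⊆⇒length≤ S! S⊆inS)

module Corona {h : ℕ} {s : Fin h → ℕ} (H : SimpleGraph (Fin h))
              (X : (i : Fin h) → SimpleGraph (Fin (s i))) where

  G : SimpleGraph (CoronaV h s)
  G = corona H X

  open Matchings G
  module Copy (i : Fin h) = Matchings (X i)

  pattern hub i = inj₁ i
  pattern leaf i x = inj₂ (i , x)

  _≟ᵥ_ : DecidableEquality (CoronaV h s)
  _≟ᵥ_ = ≡-dec-⊎ Fin._≟_ (≡-dec-Σ Fin._≟_ Fin._≟_)

  copyOf : CoronaV h s → Fin h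
  copyOf (hub i) = i
  copyOf (leaf i _) = i

  leaf-injective : ∀ {i} {x y : Fin (s i)} → (CoronaV h s ∋ leaf i x) ≡ leaf i y → x ≡ y
  leaf-injective refl = refl

  -- The corona stores a leaf edge with a proof of i ≡ i, which is refl by UIP on Fin h.
  leaf-Adj⁻ : ∀ {i} {x y : Fin (s i)} → Adj G (leaf i x) (leaf i y) → Adj (X i) x y
  leaf-Adj⁻ (p , xy) with Decidable⇒UIP.≡-irrelevant Fin._≟_ p refl
  ... | refl = xy

  leaf-neighbour : ∀ {i x} u → Adj G (leaf i x) u → u ≡ hub i ⊎ ∃ λ y → u ≡ leaf i y
  leaf-neighbour (hub _) refl = inj₁ refl
  leaf-neighbour (leaf _ y) (refl , _) = inj₂ (y , refl)

  hub∉leaves : ∀ {i} {xs : List (Fin (s i))} → (CoronaV h s ∋ hub i) ∉ map (leaf i) xs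
  hub∉leaves {i} hub∈ with ∈-map⁻ (leaf i) hub∈
  ... | _ , _ , ()

  liftEdge : (i : Fin h) → Fin (s i) × Fin (s i) → CoronaV h s × CoronaV h s
  liftEdge i (x , y) = leaf i x , leaf i y

  endpoints-liftEdge : ∀ i E → endpoints G (map (liftEdge i) E) ≡ map (leaf i) (endpoints (X i) E)
  endpoints-liftEdge i [] = refl
  endpoints-liftEdge i ((x , y) ∷ E) = cong (λ l → leaf i x ∷ leaf i y ∷ l) (endpoints-liftEdge i E)

  copyOf-leaves : ∀ {i} {xs : List (Fin (s i))} {v} → v ∈ map (leaf i) xs → copyOf v ≡ i
  copyOf-leaves {i} v∈ with ∈-map⁻ (leaf i) v∈
  ... | _ , _ , refl = refl

  ∈-leaves⁻ : {T : (i : Fin h) → List (Fin (s i))} → ∀ {v : CoronaV h s} →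
    v ∈ concatMap (λ i → map (leaf i) (T i)) (allFin h) → ∃₂ λ i x → x ∈ T i × v ≡ leaf i x
  ∈-leaves⁻ {T} v∈ with find (∈-concatMap⁻ (λ i → map (leaf i) (T i)) {allFin h} v∈)
  ... | i , _ , v∈ᵢ with ∈-map⁻ (leaf i) v∈ᵢ
  ...   | x , x∈ , refl = i , x , x∈ , refl

  restrict : (i : Fin h) → List (CoronaV h s × CoronaV h s) → List (Fin (s i) × Fin (s i))
  restrict i [] = []
  restrict i ((hub _ , _) ∷ M) = restrict i M
  restrict i ((leaf _ _ , hub _) ∷ M) = restrict i M
  restrict i ((leaf j x , leaf k y) ∷ M) with j Fin.≟ i | k Fin.≟ i
  ... | yes refl | yes refl = (x , y) ∷ restrict i M
  ... | _ | _ = restrict i M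

  restrict-sound : ∀ {i} M {e} → e ∈ restrict i M → liftEdge i e ∈ M
  restrict-sound ((hub _ , _) ∷ M) e∈ = there (restrict-sound M e∈)
  restrict-sound ((leaf _ _ , hub _) ∷ M) e∈ = there (restrict-sound M e∈)
  restrict-sound {i} ((leaf j x , leaf k y) ∷ M) e∈ with j Fin.≟ i | k Fin.≟ i
  restrict-sound _ (here refl) | yes refl | yes refl = here refl
  restrict-sound (_ ∷ M) (there e∈) | yes refl | yes refl = there (restrict-sound M e∈)
  ... | yes refl | no _ = there (restrict-sound M e∈)
  ... | no _ | _ = there (restrict-sound M e∈)

  ∈-restrict-∷ : ∀ {i} e M {c} → c ∈ restrict i M → c ∈ restrict i (e ∷ M)
  ∈-restrict-∷ (hub _ , _) M c∈ = c∈
  ∈-restrict-∷ (leaf _ _ , hub _) M c∈ = c∈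
  ∈-restrict-∷ {i} (leaf j x , leaf k y) M c∈ with j Fin.≟ i | k Fin.≟ i
  ... | yes refl | yes refl = there c∈
  ... | yes refl | no _ = c∈
  ... | no _ | _ = c∈

  restrict-complete : ∀ {i} M {x y} → (leaf i x , leaf i y) ∈ M → (x , y) ∈ restrict i M
  restrict-complete {i} (_ ∷ M) (here refl) with i Fin.≟ i
  ... | yes refl = here refl
  ... | no i≢i = contradiction refl i≢i
  restrict-complete (e ∷ M) (there xy∈) = ∈-restrict-∷ e M (restrict-complete M xy∈)

  restrict-Matched : ∀ {i} M {x y} → Copy.Matched i (restrict i M) x y → Matched M (leaf i x) (leaf i y)
  restrict-Matched M = Sum.map (restrict-sound M) (restrict-sound M)

  restrict-Matched⁻ : ∀ {i} M {x y} → Matched M (leaf i x) (leaf i y) → Copy.Matched i (restrict i M) x y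
  restrict-Matched⁻ M = Sum.map (restrict-complete M) (restrict-complete M)

  restrict-∈endpoints : ∀ {i} M {z} → z ∈ endpoints (X i) (restrict i M) → leaf i z ∈ endpoints G M
  restrict-∈endpoints {i} M z∈ =
    Matched⇒∈endpoints (restrict-Matched M (proj₂ (Copy.∈endpoints⇒Matched i z∈)))

  restrict-Unique : ∀ {i} M → Unique (endpoints G M) → Unique (endpoints (X i) (restrict i M))
  restrict-Unique [] _ = []
  restrict-Unique ((hub _ , _) ∷ M) (_ ∷ _ ∷ M!) = restrict-Unique M M!
  restrict-Unique ((leaf _ _ , hub _) ∷ M) (_ ∷ _ ∷ M!) = restrict-Unique M M!
  restrict-Unique {i} ((leaf j x , leaf k y) ∷ M) (x≢ ∷ y≢ ∷ M!) with j Fin.≟ i | k Fin.≟ i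
  ... | yes refl | yes refl = Unique-∷ x-fresh (Unique-∷ y-fresh (restrict-Unique M M!))
    where
    x-fresh : x ∉ y ∷ endpoints (X i) (restrict i M)
    x-fresh (here refl) = All.head x≢ refl
    x-fresh (there x∈) = All.lookup x≢ (there (restrict-∈endpoints M x∈)) refl
    y-fresh : y ∉ endpoints (X i) (restrict i M)
    y-fresh y∈ = All.lookup y≢ (restrict-∈endpoints M y∈) refl
  ... | yes refl | no _ = restrict-Unique M M!
  ... | no _ | _ = restrict-Unique M M!

  module FromCopies (copies : ∀ i → IsKE (X i) × HasAlmostPerfectMatching (X i)) where

    Mᵢ : (i : Fin h) → List (Fin (s i) × Fin (s i))
    Mᵢ i = proj₁ (proj₂ (copies i))

    Mᵢ-matching : ∀ i → IsMatching (X i) (Mᵢ i)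
    Mᵢ-matching i = proj₁ (proj₂ (proj₂ (copies i)))

    wᵢ : (i : Fin h) → Fin (s i)
    wᵢ i = proj₁ (proj₂ (proj₂ (proj₂ (copies i))))

    wᵢ-unsaturated : ∀ i → wᵢ i ∉ endpoints (X i) (Mᵢ i)
    wᵢ-unsaturated i = proj₁ (proj₂ (proj₂ (proj₂ (proj₂ (copies i)))))

    othersᵢ-saturated : ∀ i v → v ≢ wᵢ i → v ∈ endpoints (X i) (Mᵢ i)
    othersᵢ-saturated i = proj₂ (proj₂ (proj₂ (proj₂ (proj₂ (copies i)))))

    Sᵢ : ∀ i → Copy.HasIndependentSetOfSize i (1 + length (Mᵢ i))
    Sᵢ i = Equivalence.to
      (Copy.almostPerfect-isKE⇔independentSet i Fin._≟_
        (Mᵢ-matching i) (wᵢ-unsaturated i) (othersᵢ-saturated i))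
      (proj₁ (copies i))

    block : (i : Fin h) → List (CoronaV h s × CoronaV h s)
    block i = (hub i , leaf i (wᵢ i)) ∷ map (liftEdge i) (Mᵢ i)

    endpoints-block : ∀ i →
      endpoints G (block i) ≡ hub i ∷ map (leaf i) (wᵢ i ∷ endpoints (X i) (Mᵢ i))
    endpoints-block i = cong (λ l → hub i ∷ leaf i (wᵢ i) ∷ l) (endpoints-liftEdge i (Mᵢ i))

    M : List (CoronaV h s × CoronaV h s)
    M = concatMap block (allFin h)

    M-edges : ∀ {e} → e ∈ M → Adj G (proj₁ e) (proj₂ e)
    M-edges e∈M with find (∈-concatMap⁻ block {allFin h} e∈M)
    ... | i , _ , here refl = refl
    ... | i , _ , there e∈ᵢ with ∈-map⁻ (liftEdge i) e∈ᵢ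
    ...   | _ , xy∈Mᵢ , refl = refl , proj₁ (Mᵢ-matching i) xy∈Mᵢ

    block-Unique : ∀ i → Unique (endpoints G (block i))
    block-Unique i = subst Unique (sym (endpoints-block i))
      (Unique-∷ hub∉leaves (map⁺ leaf-injective
        (Unique-∷ (wᵢ-unsaturated i) (proj₂ (Mᵢ-matching i)))))

    block-owned : ∀ i {v} → v ∈ endpoints G (block i) → copyOf v ≡ i
    block-owned i {v} v∈ with subst (v ∈_) (endpoints-block i) v∈
    ... | here refl = refl
    ... | there v∈leaves = copyOf-leaves v∈leaves

    M-matching : IsMatching G M
    M-matching = M-edges , subst Unique (sym (endpoints-concatMap block (allFin h)))
      (Unique-concatMap (endpoints G ∘ block) copyOf block-owned block-Unique (allFin⁺ h))

    M-perfect : ∀ v → v ∈ endpoints G M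
    M-perfect v = subst (v ∈_) (sym (endpoints-concatMap block (allFin h)))
      (∈-concatMap⁺ (endpoints G ∘ block) (lose (∈-allFin (copyOf v)) (∈-block v)))
      where
      ∈-block : ∀ v → v ∈ endpoints G (block (copyOf v))
      ∈-block (hub i) = here refl
      ∈-block (leaf i x) = subst (leaf i x ∈_) (sym (endpoints-block i))
        (there (∈-map⁺ (leaf i) (∈-∷-complete Fin._≟_ (othersᵢ-saturated i) x)))

    leaves : (i : Fin h) → List (CoronaV h s)
    leaves i = map (leaf i) (proj₁ (Sᵢ i))

    S : List (CoronaV h s)
    S = concatMap leaves (allFin h)

    S-independent : IsIndependent G S
    S-independent = Unique-concatMap leaves copyOf (λ _ → copyOf-leaves) leaves-Unique (allFin⁺ h) , non-adjacent
      where
      leaves-Unique : ∀ i → Unique (leaves i)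
      leaves-Unique i = map⁺ leaf-injective (proj₁ (proj₁ (proj₂ (Sᵢ i))))
      non-adjacent : ∀ {u v} → u ∈ S → v ∈ S → ¬ Adj G u v
      non-adjacent u∈ v∈ with ∈-leaves⁻ u∈ | ∈-leaves⁻ v∈
      ... | i , x , x∈ , refl | _ , y , y∈ , refl =
        λ { (refl , xy) → proj₂ (proj₁ (proj₂ (Sᵢ i))) x∈ y∈ xy }

    |S|≡|M| : length S ≡ length M
    |S|≡|M| = length-concatMap-cong leaves block |leaves|≡|block| (allFin h)
      where
      |leaves|≡|block| : ∀ i → length (leaves i) ≡ length (block i)
      |leaves|≡|block| i = trans (length-map _ (proj₁ (Sᵢ i)))
        (trans (proj₂ (proj₂ (Sᵢ i))) (cong suc (sym (length-map (liftEdge i) (Mᵢ i)))))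

    corona-isKE×perfect : IsKE G × HasPerfectMatching G
    corona-isKE×perfect =
      Equivalence.from (perfect-isKE⇔independentSet _≟ᵥ_ M-matching M-perfect)
        (S , S-independent , |S|≡|M|) ,
      M , M-matching , M-perfect

  module ToCopies (nonempty : ∀ i → 1 ≤ s i) (ke : IsKE G) {M} (M-matching : IsMatching G M)
                  (M-perfect : ∀ v → v ∈ endpoints G M) where

    open DecMembership _≟ᵥ_ using (_∈?_)

    S-data : HasIndependentSetOfSize (length M)
    S-data = Equivalence.to (perfect-isKE⇔independentSet _≟ᵥ_ M-matching M-perfect) ke

    S : List (CoronaV h s)
    S = proj₁ S-data

    S-indep : ∀ {u v} → u ∈ S → v ∈ S → ¬ Adj G u v
    S-indep = proj₂ (proj₁ (proj₂ S-data))

    edge-meets : ∀ {u v} → (u , v) ∈ M → u ∈ S ⊎ v ∈ S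
    edge-meets =
      perfect-independent-meets-edges _≟ᵥ_ M-matching M-perfect (proj₁ (proj₂ S-data)) (proj₂ (proj₂ S-data))

    meets : ∀ {u v} → Matched M u v → u ∈ S ⊎ v ∈ S
    meets (inj₁ uv∈M) = edge-meets uv∈M
    meets (inj₂ vu∈M) = Sum.swap (edge-meets vu∈M)

    mate : ∀ v → ∃ (Matched M v)
    mate v = ∈endpoints⇒Matched (M-perfect v)

    mate-unique : ∀ {u v v′} → Matched M u v → Matched M u v′ → v ≡ v′
    mate-unique = Matched-unique (proj₂ M-matching)

    hub∈S⇒copy-unmatched : ∀ {i x y} → hub i ∈ S → ¬ Matched M (leaf i x) (leaf i y)
    hub∈S⇒copy-unmatched hub∈S m =
      [ (λ x∈S → S-indep hub∈S x∈S refl) , (λ y∈S → S-indep hub∈S y∈S refl) ] (meets m)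

    -- Copy i is nonempty; the mate of one of its leaves cannot be hub i (already matched to hub j),
    -- so it is a leaf of copy i.
    hub∈S⇒not-matched-to-hub : ∀ {i j} → hub i ∈ S → ¬ Matched M (hub i) (hub j)
    hub∈S⇒not-matched-to-hub {i} hub∈S hub-hub with mate (leaf i (fromℕ< (nonempty i)))
    ... | u , leaf-u with leaf-neighbour u (Matched⇒Adj M-matching leaf-u)
    ...   | inj₁ refl with () ← mate-unique hub-hub (Matched-sym leaf-u)
    ...   | inj₂ (_ , refl) = hub∈S⇒copy-unmatched hub∈S leaf-u

    hub-mate : ∀ i → ∃ λ w → Matched M (hub i) (leaf i w)
    hub-mate i with mate (hub i)
    ... | leaf j w , m with Matched⇒Adj M-matching m
    ...   | refl = w , m
    hub-mate i | hub j , m with meets m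
    ... | inj₁ hubᵢ∈S = ⊥-elim (hub∈S⇒not-matched-to-hub hubᵢ∈S m)
    ... | inj₂ hubⱼ∈S = ⊥-elim (hub∈S⇒not-matched-to-hub hubⱼ∈S (Matched-sym m))

    module _ (i : Fin h) where

      w : Fin (s i)
      w = proj₁ (hub-mate i)

      hub-w : Matched M (hub i) (leaf i w)
      hub-w = proj₂ (hub-mate i)

      Mᵢ : List (Fin (s i) × Fin (s i))
      Mᵢ = restrict i M

      Mᵢ-matching : IsMatching (X i) Mᵢ
      Mᵢ-matching =
        (λ e∈ → leaf-Adj⁻ (proj₁ M-matching (restrict-sound M e∈))) , restrict-Unique M (proj₂ M-matching)

      w-unsaturated : w ∉ endpoints (X i) Mᵢ
      w-unsaturated w∈
        with () ← mate-unique (Matched-sym hub-w) (restrict-Matched M (proj₂ (Copy.∈endpoints⇒Matched i w∈)))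

      others-saturated : ∀ x → x ≢ w → x ∈ endpoints (X i) Mᵢ
      others-saturated x x≢w with mate (leaf i x)
      ... | u , x-u with leaf-neighbour u (Matched⇒Adj M-matching x-u)
      ...   | inj₁ refl = contradiction (leaf-injective (mate-unique (Matched-sym x-u) hub-w)) x≢w
      ...   | inj₂ (_ , refl) = Copy.Matched⇒∈endpoints i (restrict-Matched⁻ M x-u)

      hub∈S⇒Mᵢ≡[] : hub i ∈ S → Mᵢ ≡ []
      hub∈S⇒Mᵢ≡[] hub∈S =
        no-members⇒≡[] λ e∈ → hub∈S⇒copy-unmatched hub∈S (inj₁ (restrict-sound M e∈))

      leaf∈S? : Decidable (λ x → leaf i x ∈ S)
      leaf∈S? x = leaf i x ∈? S

      inS : Fin (s i) × Fin (s i) → Fin (s i)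
      inS = Copy.pickBy i leaf∈S?

      inS-∈S : ∀ {e} → e ∈ Mᵢ → leaf i (inS e) ∈ S
      inS-∈S e∈ = Copy.pickBy-sat i leaf∈S? (edge-meets (restrict-sound M e∈))

      w∷inS-independent : leaf i w ∈ S → IsIndependent (X i) (w ∷ map inS Mᵢ)
      w∷inS-independent w∈S =
        Unique-∷ (w-unsaturated ∘ Copy.pickBy-∈-endpoints i leaf∈S?)
                 (Copy.pickBy-Unique i leaf∈S? Mᵢ (proj₂ Mᵢ-matching)) ,
        λ t∈ t′∈ tt′ → S-indep (∈S t∈) (∈S t′∈) (refl , tt′)
        where
        ∈S : ∀ {t} → t ∈ w ∷ map inS Mᵢ → leaf i t ∈ S
        ∈S (here refl) = w∈S
        ∈S (there t∈) with _ , e∈ , refl ← ∈-map⁻ inS t∈ = inS-∈S e∈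

      singleton-independent : IsIndependent (X i) (w ∷ [])
      singleton-independent = Unique-∷ (λ ()) [] , λ { (here refl) (here refl) → irrefl (X i) }

      copy-independent : Copy.HasIndependentSetOfSize i (1 + length Mᵢ)
      copy-independent with meets hub-w
      ... | inj₁ hub∈S =
        w ∷ [] , singleton-independent , cong (suc ∘ length) (sym (hub∈S⇒Mᵢ≡[] hub∈S))
      ... | inj₂ w∈S = w ∷ map inS Mᵢ , w∷inS-independent w∈S , cong suc (length-map inS Mᵢ)

      copy-isKE×almostPerfect : IsKE (X i) × HasAlmostPerfectMatching (X i)
      copy-isKE×almostPerfect =
        Equivalence.from
          (Copy.almostPerfect-isKE⇔independentSet i Fin._≟_ Mᵢ-matching w-unsaturated others-saturated)
          copy-independent ,
        Mᵢ , Mᵢ-matching , w , w-unsaturated , others-saturated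

corollary2p5 : (h : ℕ) (s : Fin h → ℕ) (H : SimpleGraph (Fin h))
    (X : (i : Fin h) → SimpleGraph (Fin (s i))) →
    (∀ i → 1 ≤ s i) →
    ((IsKE (corona H X) × HasPerfectMatching (corona H X)) ⇔
     (∀ i → IsKE (X i) × HasAlmostPerfectMatching (X i)))
corollary2p5 h s H X nonempty = mk⇔
  (λ (ke , _ , M-matching , M-perfect) →
     ToCopies.copy-isKE×almostPerfect nonempty ke M-matching M-perfect)
  FromCopies.corona-isKE×perfect
  where open Corona H X
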